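{- For $n\ge3$, each of the statistics $\operatorname{inv}$, $\operatorname{inv}_B$, and $\operatorname{des}_B$ on $B_n$ has degree $2$; that is, each lies in the real span of the indicator functions of partial colored permutations of size at most $2$, but not in the real span of the indicator functions of partial colored permutations of size at most $1$.
   Context: $B_n$ is the group of permutations $\omega$ of $\{\pm1,\dots,\pm n\}$ with $\omega(-i)=-\omega(i)$. $\operatorname{inv}(\omega)=|\{(i,j)\in[n]^2:i<j,\ \omega(i)>\omega(j)\}|$, $\operatorname{neg}(\omega)=\sum_{i\in[n],\,\omega(i)<0}\omega(i)$, $\operatorname{inv}_B=\operatorname{inv}-\operatorname{neg}$, and $\operatorname{des}_B(\omega)=|\{i\in\{0,\dots,n-1\}:\omega(i)>\omega(i+1)\}|$ with $\omega(0)=0$. A partial colored permutation of size $m$ on $B_n$ is a set $\{(i_h,k_h)\}_{h=1}^m$ with $i_h\in[n]$ distinct, $k_h\in\{\pm1,\dots,\pm n\}$ and $|k_h|$ distinct; its indicator function takes value $1$ on $\omega$ if $\omega(i_h)=k_h$ for all $h$ and $0$ otherwise. (The size-$0$ partial colored permutation has the constant function $1$ as indicator.)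
   Formalization: The spans of indicator functions of partial colored permutations are taken with rational coefficients instead of real ones. -}

module Defs where

open import Data.Bool using (Bool; true; false; if_then_else_)
open import Data.Nat as ℕ using (ℕ; zero; suc; _≤_)
open import Data.Integer as ℤ using (ℤ; +_; -_)
open import Data.Rational as ℚ using (ℚ; 0ℚ; 1ℚ)
open import Data.Fin as Fin using (Fin; toℕ)
open import Data.Fin.Permutation using (Permutation′; _⟨$⟩ʳ_)
open import Data.List using (List; []; _∷_; length; map; filter; foldr; upTo; concatMap)
open import Data.List.Relation.Unary.All using (All; all?)
open import Data.List.Relation.Unary.Unique.Propositional using (Unique)
open import Data.Product using (_×_; _,_; proj₁; proj₂; ∃)
open import Data.Fin.Base using () 
open import Data.List.Base using ()
open import Relation.Nullary using (¬_; does)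
open import Relation.Nullary.Decidable using (_×-dec_)
open import Relation.Binary.PropositionalEquality using (_≡_)
import Data.Fin.Properties as FinP
import Data.Bool.Properties as BoolP
import Data.List as L

-- A signed permutation ω is given by a permutation π of [n] (encoded as
-- Fin n, i.e. i ↦ i-1) together with a sign for each position:
--   ω(i) = + (π(i)+1)   if sign i = false
--   ω(i) = - (π(i)+1)   if sign i = true
-- (and ω(-i) = -ω(i), which is determined).  This is a bijection between
-- B_n and Permutation′ n × (Fin n → Bool).

record SignedPerm (n : ℕ) : Set where
  constructor mkSP
  field
    perm : Permutation′ n
    neg? : Fin n → Bool

open SignedPerm public

-- value ω(i) ∈ {±1,…,±n} as an integer (i : Fin n stands for i+1 ∈ [n])
val : ∀ {n} → SignedPerm n → Fin n → ℤ
val ω i with neg? ω i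
... | true  = - (+ suc (toℕ (perm ω ⟨$⟩ʳ i)))
... | false = + suc (toℕ (perm ω ⟨$⟩ʳ i))

allPairs : (n : ℕ) → List (Fin n × Fin n)
allPairs n = concatMap (λ i → map (λ j → (i , j)) (L.allFin n)) (L.allFin n)

inv : ∀ {n} → SignedPerm n → ℕ
inv {n} ω = length (filter (λ p → (proj₁ p Fin.<? proj₂ p) ×-dec (val ω (proj₂ p) ℤ.<? val ω (proj₁ p))) (allPairs n))

negSum : ∀ {n} → SignedPerm n → ℤ
negSum {n} ω = foldr (λ i acc → (if neg? ω i then val ω i else + 0) ℤ.+ acc) (+ 0) (L.allFin n)

invB : ∀ {n} → SignedPerm n → ℤ
invB ω = + inv ω ℤ.- negSum ω

-- ω extended to {0,…,n} by ω(0) = 0:  ext ω m = ω(m)  (m ∈ ℕ, 1 ≤ m ≤ n)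
ext : ∀ {n} → SignedPerm n → ℕ → ℤ
ext ω zero = + 0
ext {n} ω (suc m) with m ℕ.<? n
... | Relation.Nullary.yes m<n = val ω (Fin.fromℕ< m<n)
... | Relation.Nullary.no  _   = + 0

desB : ∀ {n} → SignedPerm n → ℕ
desB {n} ω = length (filter (λ i → ext ω (suc i) ℤ.<? ext ω i) (upTo n))

-- Partial colored permutations.
-- An entry (i , s , a) encodes the pair (i+1 , k) with k = +(a+1) if
-- s = false and k = -(a+1) if s = true.

Entry : ℕ → Set
Entry n = Fin n × Bool × Fin n

pos : ∀ {n} → Entry n → Fin n
pos = proj₁

absv : ∀ {n} → Entry n → Fin n
absv e = proj₂ (proj₂ e)

record PCP (n : ℕ) : Set where
  constructor mkPCP
  field
    entries      : List (Entry n)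
    distinctPos  : Unique (map pos entries)
    distinctAbs  : Unique (map absv entries)

open PCP public

size : ∀ {n} → PCP n → ℕ
size P = length (entries P)

indicator : ∀ {n} → PCP n → SignedPerm n → ℚ
indicator P ω =
  if does (all? (λ { (i , s , a) → (neg? ω i BoolP.≟ s) ×-dec (perm ω ⟨$⟩ʳ i FinP.≟ a) }) (entries P))
  then 1ℚ else 0ℚ

sumℚ : List ℚ → ℚ
sumℚ = foldr ℚ._+_ 0ℚ

InSpan : (n d : ℕ) → (SignedPerm n → ℚ) → Set
InSpan n d f =
  ∃ λ (L : List (ℚ × PCP n)) →
    All (λ cP → size (proj₂ cP) ≤ d) L ×
    (∀ ω → f ω ≡ sumℚ (map (λ cP → proj₁ cP ℚ.* indicator (proj₂ cP) ω) L))

HasDegree2 : (n : ℕ) → (SignedPerm n → ℚ) → Set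
HasDegree2 n f = InSpan n 2 f × ¬ InSpan n 1 f

ℕtoℚ : ℕ → ℚ
ℕtoℚ k = + k ℚ./ 1

ℤtoℚ : ℤ → ℚ
ℤtoℚ z = z ℚ./ 1

{-# OPTIONS --safe #-}
-- Upper bound: inv, inv_B and des_B are sums of terms each depending only on
-- the values at one or two positions ([ω(j) < ω(i)], the negative part of
-- ω(i), [ω(1) < 0], [ω(k+1) < ω(k)]), and a function g of (ω(i), ω(j))
-- equals Σ_{k,l} g(k,l) [ω(i) = k, ω(j) = l].
-- Lower bound: let S₃ act on the first three positions, fixing all other
-- positions and all signs. Every indicator of size ≤ 1 has the same total
-- over the three even permutations as over the three odd ones, hence so has
-- every function of degree ≤ 1. But inv totals 4 against 5 there (inv_B
-- agrees with inv on unsigned permutations), and des_B totals 2 against 4.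
module Submission where

open import Defs
open import Data.Nat using (ℕ; _≤_)
open import Data.Product using (_×_)

open import Algebra.Bundles using (CommutativeMonoid)
open import Data.Bool using (Bool; true; false; if_then_else_; _∧_)
import Data.Bool.Properties as BoolP
open import Data.Fin as Fin using (Fin; suc; toℕ; fromℕ<; splitAt; join; _↑ˡ_; _↑ʳ_)
open import Data.Fin.Patterns using (0F; 1F; 2F)
import Data.Fin.Properties as FinP
open import Data.Fin.Permutation using (Permutation′; permutation; _⟨$⟩ʳ_; _⟨$⟩ˡ_; inverseˡ; inverseʳ; id; transpose; _∘ₚ_)
open import Data.Integer as ℤ using (ℤ; +_; +<+)
import Data.Integer.Properties as ℤP
open import Data.List using (List; []; _∷_; _++_; map; concatMap; foldr; filter; length; allFin; upTo; applyUpTo; cartesianProduct)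
import Data.List.Properties as ListP
open import Data.List.Membership.Propositional using (_∈_)
open import Data.List.Membership.Propositional.Properties using (∈-allFin; ∈-cartesianProduct⁺)
open import Data.List.Relation.Unary.All as All using (All; []; _∷_)
import Data.List.Relation.Unary.All.Properties as AllP
open import Data.List.Relation.Unary.AllPairs using ([]; _∷_)
open import Data.List.Relation.Unary.Any using (here; there)
open import Data.List.Relation.Unary.Unique.Propositional using (Unique)
import Data.List.Relation.Unary.Unique.Propositional.Properties as Uniqueₚ
open import Data.Nat as ℕ using (zero; suc; z≤n; s≤s; s<s; _<_)
import Data.Nat.Properties as ℕP
open import Data.Nat.Coprimality using (1-coprimeTo) renaming (sym to coprime-sym)
open import Data.Product using (_,_; proj₁; proj₂; uncurry)
open import Data.Product.Properties using (×-≡,≡←≡)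
open import Data.Rational as ℚ using (ℚ; 0ℚ; 1ℚ; mkℚ)
import Data.Rational.Properties as ℚP
open import Algebra.Properties.CommutativeSemigroup
  (CommutativeMonoid.commutativeSemigroup ℚP.+-0-commutativeMonoid) using (interchange)
open import Data.Sum as Sum using (_⊎_; inj₁; inj₂)
open import Function using (_∘_)
open import Function.Bundles using (Injection)
open import Function.Properties.Inverse using (Inverse⇒Injection)
open import Relation.Binary.Definitions using (DecidableEquality)
open import Relation.Binary.PropositionalEquality
open import Relation.Nullary using (¬_; Dec; yes; no; does; contradiction; _×-dec_)
import Relation.Nullary.Decidable as Dec
open import Relation.Unary using (Decidable)

private
  variable
    A B : Set
    n d e k m : ℕ

-- The same number as ℤtoℚ z, but with its denominator exposed, so that
-- the sum of two of them unfolds to a single division by 1.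
fromℤ : ℤ → ℚ
fromℤ z = mkℚ z 0 (coprime-sym (1-coprimeTo _))

ℤtoℚ≡fromℤ : ∀ z → ℤtoℚ z ≡ fromℤ z
ℤtoℚ≡fromℤ z = ℚP.↥p/↧p≡p (fromℤ z)

ℤtoℚ-+ : ∀ a b → ℤtoℚ (a ℤ.+ b) ≡ ℤtoℚ a ℚ.+ ℤtoℚ b
ℤtoℚ-+ a b = begin
  ℤtoℚ (a ℤ.+ b)                   ≡⟨ cong ℤtoℚ (cong₂ ℤ._+_ (ℤP.*-identityʳ a) (ℤP.*-identityʳ b)) ⟨
  ℤtoℚ (a ℤ.* + 1 ℤ.+ b ℤ.* + 1)   ≡⟨⟩
  fromℤ a ℚ.+ fromℤ b              ≡⟨ cong₂ ℚ._+_ (ℤtoℚ≡fromℤ a) (ℤtoℚ≡fromℤ b) ⟨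
  ℤtoℚ a ℚ.+ ℤtoℚ b                ∎
  where open ≡-Reasoning

ℕtoℚ-suc : ∀ k → ℕtoℚ (suc k) ≡ 1ℚ ℚ.+ ℕtoℚ k
ℕtoℚ-suc k = ℤtoℚ-+ (+ 1) (+ k)

𝟙 : Bool → ℚ
𝟙 b = if b then 1ℚ else 0ℚ

ℤtoℚ-neg-foldr : ∀ (t : A → ℤ) xs →
  ℤtoℚ (ℤ.- foldr (λ x acc → t x ℤ.+ acc) (+ 0) xs) ≡ sumℚ (map (λ x → ℤtoℚ (ℤ.- t x)) xs)
ℤtoℚ-neg-foldr t []       = refl
ℤtoℚ-neg-foldr t (x ∷ xs) = begin
  ℤtoℚ (ℤ.- (t x ℤ.+ s))             ≡⟨ cong ℤtoℚ (ℤP.neg-distrib-+ (t x) s) ⟩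
  ℤtoℚ (ℤ.- t x ℤ.+ ℤ.- s)           ≡⟨ ℤtoℚ-+ (ℤ.- t x) (ℤ.- s) ⟩
  ℤtoℚ (ℤ.- t x) ℚ.+ ℤtoℚ (ℤ.- s)    ≡⟨ cong (ℤtoℚ (ℤ.- t x) ℚ.+_) (ℤtoℚ-neg-foldr t xs) ⟩
  sumℚ (map (λ x → ℤtoℚ (ℤ.- t x)) (x ∷ xs)) ∎
  where
  open ≡-Reasoning
  s = foldr (λ x acc → t x ℤ.+ acc) (+ 0) xs

sumℚ-++ : ∀ xs ys → sumℚ (xs ++ ys) ≡ sumℚ xs ℚ.+ sumℚ ys
sumℚ-++ []       ys = sym (ℚP.+-identityˡ (sumℚ ys))
sumℚ-++ (x ∷ xs) ys = trans (cong (x ℚ.+_) (sumℚ-++ xs ys)) (sym (ℚP.+-assoc x (sumℚ xs) (sumℚ ys)))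

sumℚ-concatMap : ∀ (f : B → ℚ) (g : A → List B) xs →
  sumℚ (map f (concatMap g xs)) ≡ sumℚ (map (λ x → sumℚ (map f (g x))) xs)
sumℚ-concatMap f g []       = refl
sumℚ-concatMap f g (x ∷ xs) = begin
  sumℚ (map f (g x ++ concatMap g xs))             ≡⟨ cong sumℚ (ListP.map-++ f (g x) (concatMap g xs)) ⟩
  sumℚ (map f (g x) ++ map f (concatMap g xs))     ≡⟨ sumℚ-++ (map f (g x)) (map f (concatMap g xs)) ⟩
  sumℚ (map f (g x)) ℚ.+ sumℚ (map f (concatMap g xs)) ≡⟨ cong (sumℚ (map f (g x)) ℚ.+_) (sumℚ-concatMap f g xs) ⟩
  sumℚ (map (λ x → sumℚ (map f (g x))) (x ∷ xs))  ∎
  where open ≡-Reasoning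

sumℚ-map-+ : ∀ (f g : A → ℚ) xs →
  sumℚ (map (λ x → f x ℚ.+ g x) xs) ≡ sumℚ (map f xs) ℚ.+ sumℚ (map g xs)
sumℚ-map-+ f g []       = refl
sumℚ-map-+ f g (x ∷ xs) =
  trans (cong (f x ℚ.+ g x ℚ.+_) (sumℚ-map-+ f g xs)) (interchange (f x) (g x) _ _)

sumℚ-map-*ˡ : ∀ c (f : A → ℚ) xs → sumℚ (map (λ x → c ℚ.* f x) xs) ≡ c ℚ.* sumℚ (map f xs)
sumℚ-map-*ˡ c f []       = sym (ℚP.*-zeroʳ c)
sumℚ-map-*ˡ c f (x ∷ xs) =
  trans (cong (c ℚ.* f x ℚ.+_) (sumℚ-map-*ˡ c f xs)) (sym (ℚP.*-distribˡ-+ c (f x) _))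

sumℚ-zero : ∀ {f : A → ℚ} {xs} → All (λ x → f x ≡ 0ℚ) xs → sumℚ (map f xs) ≡ 0ℚ
sumℚ-zero []             = refl
sumℚ-zero (fx≡0 ∷ fxs≡0) = cong₂ ℚ._+_ fx≡0 (sumℚ-zero fxs≡0)

*-𝟙-≢ : ∀ (_≟_ : DecidableEquality A) (h : A → ℚ) {x y} → x ≢ y → h y ℚ.* 𝟙 (does (x ≟ y)) ≡ 0ℚ
*-𝟙-≢ _≟_ h {x} {y} x≢y = trans (cong (λ b → h y ℚ.* 𝟙 b) (Dec.dec-false (x ≟ y) x≢y)) (ℚP.*-zeroʳ (h y))

sumℚ-δ : ∀ (_≟_ : DecidableEquality A) (h : A → ℚ) {x xs} → Unique xs → x ∈ xs →
  sumℚ (map (λ y → h y ℚ.* 𝟙 (does (x ≟ y))) xs) ≡ h x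
sumℚ-δ _≟_ h {x} (x∉xs ∷ _) (here refl) = begin
  h x ℚ.* 𝟙 (does (x ≟ x)) ℚ.+ _  ≡⟨ cong₂ ℚ._+_ (cong (λ b → h x ℚ.* 𝟙 b) (Dec.dec-true (x ≟ x) refl))
                                                 (sumℚ-zero (All.map (*-𝟙-≢ _≟_ h) x∉xs)) ⟩
  h x ℚ.* 1ℚ ℚ.+ 0ℚ               ≡⟨ ℚP.+-identityʳ _ ⟩
  h x ℚ.* 1ℚ                      ≡⟨ ℚP.*-identityʳ (h x) ⟩
  h x                             ∎
  where open ≡-Reasoning
sumℚ-δ _≟_ h {x} {y ∷ ys} (y∉ys ∷ ys!) (there x∈ys) = begin
  h y ℚ.* 𝟙 (does (x ≟ y)) ℚ.+ sumℚ (map (λ z → h z ℚ.* 𝟙 (does (x ≟ z))) ys)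
    ≡⟨ cong₂ ℚ._+_ (*-𝟙-≢ _≟_ h (≢-sym (All.lookup y∉ys x∈ys))) (sumℚ-δ _≟_ h ys! x∈ys) ⟩
  0ℚ ℚ.+ h x
    ≡⟨ ℚP.+-identityˡ (h x) ⟩
  h x ∎
  where open ≡-Reasoning

Cell : ℕ → Set
Cell n = Bool × Fin n

cellAt : SignedPerm n → Fin n → Cell n
cellAt ω i = neg? ω i , perm ω ⟨$⟩ʳ i

signedValue : Cell n → ℤ
signedValue (true  , a) = ℤ.- (+ suc (toℕ a))
signedValue (false , a) = + suc (toℕ a)

val-cellAt : ∀ (ω : SignedPerm n) i → val ω i ≡ signedValue (cellAt ω i)
val-cellAt ω i with neg? ω i
... | true  = refl
... | false = refl

×-≟ : DecidableEquality A → DecidableEquality B → DecidableEquality (A × B)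
×-≟ _≟₁_ _≟₂_ (a , b) (c , d) = Dec.map′ (uncurry (cong₂ _,_)) ×-≡,≡←≡ ((a ≟₁ c) ×-dec (b ≟₂ d))

_≟ᶜ_ : DecidableEquality (Cell n)
_≟ᶜ_ = ×-≟ BoolP._≟_ FinP._≟_

_≟ᶜ²_ : DecidableEquality (Cell n × Cell n)
_≟ᶜ²_ = ×-≟ _≟ᶜ_ _≟ᶜ_

cells : (n : ℕ) → List (Cell n)
cells n = cartesianProduct (false ∷ true ∷ []) (allFin n)

cells-unique : Unique (cells n)
cells-unique {n} = Uniqueₚ.cartesianProduct⁺ (((λ ()) ∷ []) ∷ [] ∷ []) (Uniqueₚ.allFin⁺ n)

∈-cells : ∀ (c : Cell n) → c ∈ cells n
∈-cells (s , a) = ∈-cartesianProduct⁺ (∈-bools s) (∈-allFin a)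
  where
  ∈-bools : ∀ b → b ∈ false ∷ true ∷ []
  ∈-bools false = here refl
  ∈-bools true  = there (here refl)

⟨_↦_⟩ : Fin n → Cell n → PCP n
⟨ i ↦ c ⟩ = mkPCP ((i , c) ∷ []) ([] ∷ []) ([] ∷ [])

twoEntries : {i j : Fin n} {c c′ : Cell n} → i ≢ j → proj₂ c ≢ proj₂ c′ → PCP n
twoEntries {i = i} {j} {c} {c′} i≢j a≢a′ =
  mkPCP ((i , c) ∷ (j , c′) ∷ []) ((i≢j ∷ []) ∷ [] ∷ []) ((a≢a′ ∷ []) ∷ [] ∷ [])

indicator-⟨↦⟩ : ∀ i c (ω : SignedPerm n) → indicator ⟨ i ↦ c ⟩ ω ≡ 𝟙 (does (cellAt ω i ≟ᶜ c))
indicator-⟨↦⟩ i c ω = cong 𝟙 (BoolP.∧-identityʳ _)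

indicator-twoEntries : ∀ {i j : Fin n} {c c′} (i≢j : i ≢ j) (a≢a′ : proj₂ c ≢ proj₂ c′) ω →
  indicator (twoEntries i≢j a≢a′) ω ≡ 𝟙 (does ((cellAt ω i , cellAt ω j) ≟ᶜ² (c , c′)))
indicator-twoEntries {i = i} {j} {c} {c′} _ _ ω =
  cong (λ b → 𝟙 (does (cellAt ω i ≟ᶜ c) ∧ b)) (BoolP.∧-identityʳ _)

⟦_⟧ : List (ℚ × PCP n) → SignedPerm n → ℚ
⟦ L ⟧ ω = sumℚ (map (λ cP → proj₁ cP ℚ.* indicator (proj₂ cP) ω) L)

⟦⟧-++ : ∀ (L L′ : List (ℚ × PCP n)) ω → ⟦ L ++ L′ ⟧ ω ≡ ⟦ L ⟧ ω ℚ.+ ⟦ L′ ⟧ ω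
⟦⟧-++ L L′ ω = trans (cong sumℚ (ListP.map-++ term L L′)) (sumℚ-++ (map term L) (map term L′))
  where term = λ (cP : ℚ × PCP _) → proj₁ cP ℚ.* indicator (proj₂ cP) ω

InSpan-cong : ∀ {f g : SignedPerm n → ℚ} → (∀ ω → f ω ≡ g ω) → InSpan n d f → InSpan n d g
InSpan-cong f≗g (L , small , f≡) = L , small , λ ω → trans (sym (f≗g ω)) (f≡ ω)

InSpan-mono : ∀ {f : SignedPerm n → ℚ} → d ≤ e → InSpan n d f → InSpan n e f
InSpan-mono d≤e (L , small , f≡) = L , All.map (λ s → ℕP.≤-trans s d≤e) small , f≡

InSpan-zero : InSpan n d (λ _ → 0ℚ)
InSpan-zero = [] , [] , λ _ → refl

InSpan-+ : ∀ {f g : SignedPerm n → ℚ} → InSpan n d f → InSpan n d g → InSpan n d (λ ω → f ω ℚ.+ g ω)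
InSpan-+ (L , smallL , f≡) (L′ , smallL′ , g≡) =
  L ++ L′ , AllP.++⁺ smallL smallL′ , λ ω → trans (cong₂ ℚ._+_ (f≡ ω) (g≡ ω)) (sym (⟦⟧-++ L L′ ω))

InSpan-sum : ∀ (F : A → SignedPerm n → ℚ) {xs} → All (λ x → InSpan n d (F x)) xs →
  InSpan n d (λ ω → sumℚ (map (λ x → F x ω) xs))
InSpan-sum F []         = InSpan-zero
InSpan-sum F (Fx ∷ Fxs) = InSpan-+ Fx (InSpan-sum F Fxs)

InSpan-cell₁ : ∀ (i : Fin n) (g : Cell n → ℚ) → InSpan n 1 (λ ω → g (cellAt ω i))
InSpan-cell₁ {n} i g = L , AllP.map⁺ (All.universal (λ _ → ℕP.≤-refl) (cells n)) , expansion
  where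
  L = map (λ c → g c , ⟨ i ↦ c ⟩) (cells n)
  expansion : ∀ ω → g (cellAt ω i) ≡ ⟦ L ⟧ ω
  expansion ω = sym (begin
    ⟦ L ⟧ ω
      ≡⟨ cong sumℚ (ListP.map-∘ (cells n)) ⟨
    sumℚ (map (λ c → g c ℚ.* indicator ⟨ i ↦ c ⟩ ω) (cells n))
      ≡⟨ cong sumℚ (ListP.map-cong (λ c → cong (g c ℚ.*_) (indicator-⟨↦⟩ i c ω)) (cells n)) ⟩
    sumℚ (map (λ c → g c ℚ.* 𝟙 (does (cellAt ω i ≟ᶜ c))) (cells n))
      ≡⟨ sumℚ-δ _≟ᶜ_ g cells-unique (∈-cells (cellAt ω i)) ⟩
    g (cellAt ω i) ∎)
    where open ≡-Reasoning

InSpan-cell₂ : ∀ {i j : Fin n} → i ≢ j → (g : Cell n → Cell n → ℚ) →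
  InSpan n 2 (λ ω → g (cellAt ω i) (cellAt ω j))
InSpan-cell₂ {n} {i} {j} i≢j g =
  L , AllP.concat⁺ (AllP.map⁺ (All.universal term-small pairs)) , expansion
  where
  pairs = cartesianProduct (cells n) (cells n)

  -- Two cells with equal absolute values do not form a partial colored
  -- permutation; ω being injective, their term would vanish anyway.
  term : Cell n × Cell n → List (ℚ × PCP n)
  term (c , c′) with proj₂ c FinP.≟ proj₂ c′
  ... | yes _    = []
  ... | no a≢a′ = (g c c′ , twoEntries i≢j a≢a′) ∷ []

  L = concatMap term pairs

  term-small : ∀ cc → All (λ cP → size (proj₂ cP) ≤ 2) (term cc)
  term-small (c , c′) with proj₂ c FinP.≟ proj₂ c′
  ... | yes _ = []
  ... | no _  = ℕP.≤-refl ∷ []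

  ⟦term⟧ : ∀ ω cc → ⟦ term cc ⟧ ω ≡ uncurry g cc ℚ.* 𝟙 (does ((cellAt ω i , cellAt ω j) ≟ᶜ² cc))
  ⟦term⟧ ω (c , c′) with proj₂ c FinP.≟ proj₂ c′
  ... | yes a≡a′ = sym (*-𝟙-≢ _≟ᶜ²_ (uncurry g) {x = cellAt ω i , cellAt ω j} λ eq →
          i≢j (Injection.injective (Inverse⇒Injection (perm ω))
                 (trans (cong (proj₂ ∘ proj₁) eq) (trans a≡a′ (sym (cong (proj₂ ∘ proj₂) eq))))))
  ... | no a≢a′ = trans (ℚP.+-identityʳ _)
                         (cong (g c c′ ℚ.*_) (indicator-twoEntries {c = c} {c′} i≢j a≢a′ ω))

  expansion : ∀ ω → g (cellAt ω i) (cellAt ω j) ≡ ⟦ L ⟧ ω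
  expansion ω = sym (begin
    ⟦ L ⟧ ω
      ≡⟨ sumℚ-concatMap _ term pairs ⟩
    sumℚ (map (λ cc → ⟦ term cc ⟧ ω) pairs)
      ≡⟨ cong sumℚ (ListP.map-cong (⟦term⟧ ω) pairs) ⟩
    sumℚ (map (λ cc → uncurry g cc ℚ.* 𝟙 (does ((cellAt ω i , cellAt ω j) ≟ᶜ² cc))) pairs)
      ≡⟨ sumℚ-δ _≟ᶜ²_ (uncurry g) (Uniqueₚ.cartesianProduct⁺ cells-unique cells-unique)
                                  (∈-cartesianProduct⁺ (∈-cells _) (∈-cells _)) ⟩
    g (cellAt ω i) (cellAt ω j) ∎)
    where open ≡-Reasoning

InSpan-val₁ : ∀ (i : Fin n) (g : ℤ → ℚ) → InSpan n 1 (λ ω → g (val ω i))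
InSpan-val₁ i g = InSpan-cong (λ ω → cong g (sym (val-cellAt ω i))) (InSpan-cell₁ i (g ∘ signedValue))

InSpan-val₂ : ∀ {i j : Fin n} → i ≢ j → (g : ℤ → ℤ → ℚ) → InSpan n 2 (λ ω → g (val ω i) (val ω j))
InSpan-val₂ {i = i} {j} i≢j g =
  InSpan-cong (λ ω → sym (cong₂ g (val-cellAt ω i) (val-cellAt ω j)))
              (InSpan-cell₂ i≢j (λ c c′ → g (signedValue c) (signedValue c′)))

-- Degree at most 2

length-filter-sum : ∀ {P : A → Set} (P? : Decidable P) xs →
  ℕtoℚ (length (filter P? xs)) ≡ sumℚ (map (λ x → 𝟙 (does (P? x))) xs)
length-filter-sum P? []       = refl
length-filter-sum P? (x ∷ xs) with does (P? x)
... | true  = trans (ℕtoℚ-suc (length (filter P? xs))) (cong (1ℚ ℚ.+_) (length-filter-sum P? xs))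
... | false = trans (length-filter-sum P? xs) (sym (ℚP.+-identityˡ _))

inverted : SignedPerm n → Fin n → Fin n → Bool
inverted ω i j = does ((i Fin.<? j) ×-dec (val ω j ℤ.<? val ω i))

inv-as-sum : ∀ (ω : SignedPerm n) →
  ℕtoℚ (inv ω) ≡ sumℚ (map (λ p → 𝟙 (inverted ω (proj₁ p) (proj₂ p))) (allPairs n))
inv-as-sum {n} ω = length-filter-sum _ (allPairs n)

sum-allPairs : ∀ (h : Fin n × Fin n → ℚ) →
  sumℚ (map h (allPairs n)) ≡ sumℚ (map (λ i → sumℚ (map (λ j → h (i , j)) (allFin n))) (allFin n))
sum-allPairs {n} h = trans (sumℚ-concatMap h _ (allFin n))
  (cong sumℚ (ListP.map-cong (λ i → cong sumℚ (sym (ListP.map-∘ (allFin n)))) (allFin n)))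

InSpan-inverted : ∀ (i j : Fin n) → InSpan n 2 (λ ω → 𝟙 (inverted ω i j))
InSpan-inverted {n} i j = guarded (i Fin.<? j)
  where
  guarded : (i<j? : Dec (i Fin.< j)) → InSpan n 2 (λ ω → 𝟙 (does (i<j? ×-dec (val ω j ℤ.<? val ω i))))
  guarded (yes i<j) = InSpan-val₂ (FinP.<⇒≢ i<j) (λ vᵢ vⱼ → 𝟙 (does (vⱼ ℤ.<? vᵢ)))
  guarded (no _)    = InSpan-zero

InSpan-inv : InSpan n 2 (λ ω → ℕtoℚ (inv ω))
InSpan-inv {n} = InSpan-cong (λ ω → sym (inv-as-sum ω))
  (InSpan-sum _ (All.universal (λ p → InSpan-inverted (proj₁ p) (proj₂ p)) (allPairs n)))

invB-as-sum : ∀ (ω : SignedPerm n) → ℤtoℚ (invB ω) ≡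
  ℕtoℚ (inv ω) ℚ.+ sumℚ (map (λ i → ℤtoℚ (ℤ.- (if neg? ω i then val ω i else + 0))) (allFin n))
invB-as-sum {n} ω = trans (ℤtoℚ-+ (+ inv ω) (ℤ.- negSum ω))
  (cong (ℕtoℚ (inv ω) ℚ.+_) (ℤtoℚ-neg-foldr (λ i → if neg? ω i then val ω i else + 0) (allFin n)))

InSpan-invB : InSpan n 2 (λ ω → ℤtoℚ (invB ω))
InSpan-invB {n} = InSpan-cong (λ ω → sym (invB-as-sum ω))
  (InSpan-+ InSpan-inv (InSpan-mono (s≤s z≤n) (InSpan-sum _ (All.universal negativePart (allFin n)))))
  where
  negativePart : ∀ i → InSpan n 1 (λ ω → ℤtoℚ (ℤ.- (if neg? ω i then val ω i else + 0)))
  negativePart i =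
    InSpan-cong (λ ω → cong (λ v → ℤtoℚ (ℤ.- (if neg? ω i then v else + 0))) (sym (val-cellAt ω i)))
                (InSpan-cell₁ i (λ c → ℤtoℚ (ℤ.- (if proj₁ c then signedValue c else + 0))))

ext-suc : ∀ (ω : SignedPerm n) {k} (k<n : k < n) → ext ω (suc k) ≡ val ω (fromℕ< k<n)
ext-suc {n} ω {k} k<n with k ℕ.<? n
... | yes _   = refl
... | no k≮n = contradiction k<n k≮n

desB-as-sum : ∀ (ω : SignedPerm n) →
  ℕtoℚ (desB ω) ≡ sumℚ (map (λ k → 𝟙 (does (ext ω (suc k) ℤ.<? ext ω k))) (upTo n))
desB-as-sum {n} ω = length-filter-sum _ (upTo n)

InSpan-descent : k < n → InSpan n 2 (λ ω → 𝟙 (does (ext ω (suc k) ℤ.<? ext ω k)))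
InSpan-descent {k = zero} 0<n =
  InSpan-cong (λ ω → cong (λ v → 𝟙 (does (v ℤ.<? + 0))) (sym (ext-suc ω 0<n)))
              (InSpan-mono (s≤s z≤n) (InSpan-val₁ (fromℕ< 0<n) (λ v → 𝟙 (does (v ℤ.<? + 0)))))
InSpan-descent {k = suc k} k+1<n =
  InSpan-cong (λ ω → sym (cong₂ (λ u v → 𝟙 (does (u ℤ.<? v))) (ext-suc ω k+1<n) (ext-suc ω k<n)))
              (InSpan-val₂ positions-differ (λ u v → 𝟙 (does (u ℤ.<? v))))
  where
  k<n = ℕP.<-trans (ℕP.n<1+n k) k+1<n
  positions-differ : fromℕ< k+1<n ≢ fromℕ< k<n
  positions-differ eq = ℕP.1+n≢n (FinP.fromℕ<-injective (suc k) k k+1<n k<n eq)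

InSpan-desB : InSpan n 2 (λ ω → ℕtoℚ (desB ω))
InSpan-desB {n} = InSpan-cong (λ ω → sym (desB-as-sum ω))
  (InSpan-sum _ (AllP.applyUpTo⁺₁ (λ k → k) n InSpan-descent))

-- Degree not at most 1

sumOver : List (SignedPerm n) → (SignedPerm n → ℚ) → ℚ
sumOver ωs f = sumℚ (map f ωs)

sumOver-⟦⟧ : ∀ (ωs : List (SignedPerm n)) L →
  sumOver ωs ⟦ L ⟧ ≡ sumℚ (map (λ cP → proj₁ cP ℚ.* sumOver ωs (indicator (proj₂ cP))) L)
sumOver-⟦⟧ ωs []            = sumℚ-zero (All.universal (λ _ → refl) ωs)
sumOver-⟦⟧ ωs ((c , P) ∷ L) = begin
  sumOver ωs (λ ω → c ℚ.* indicator P ω ℚ.+ ⟦ L ⟧ ω)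
    ≡⟨ sumℚ-map-+ (λ ω → c ℚ.* indicator P ω) ⟦ L ⟧ ωs ⟩
  sumOver ωs (λ ω → c ℚ.* indicator P ω) ℚ.+ sumOver ωs ⟦ L ⟧
    ≡⟨ cong₂ ℚ._+_ (sumℚ-map-*ˡ c (indicator P) ωs) (sumOver-⟦⟧ ωs L) ⟩
  c ℚ.* sumOver ωs (indicator P) ℚ.+
    sumℚ (map (λ cP → proj₁ cP ℚ.* sumOver ωs (indicator (proj₂ cP))) L) ∎
  where open ≡-Reasoning

span-balanced : ∀ (ωs ωs′ : List (SignedPerm n)) {f} →
  (∀ P → size P ≤ d → sumOver ωs (indicator P) ≡ sumOver ωs′ (indicator P)) →
  InSpan n d f → sumOver ωs f ≡ sumOver ωs′ f
span-balanced ωs ωs′ {f} balanced (L , small , f≡) = begin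
  sumOver ωs f
    ≡⟨ cong sumℚ (ListP.map-cong f≡ ωs) ⟩
  sumOver ωs ⟦ L ⟧
    ≡⟨ sumOver-⟦⟧ ωs L ⟩
  sumℚ (map (λ cP → proj₁ cP ℚ.* sumOver ωs (indicator (proj₂ cP))) L)
    ≡⟨ cong sumℚ (ListP.map-cong-local
         (All.map (λ {cP} s → cong (proj₁ cP ℚ.*_) (balanced (proj₂ cP) s)) small)) ⟩
  sumℚ (map (λ cP → proj₁ cP ℚ.* sumOver ωs′ (indicator (proj₂ cP))) L)
    ≡⟨ sumOver-⟦⟧ ωs′ L ⟨
  sumOver ωs′ ⟦ L ⟧
    ≡⟨ cong sumℚ (ListP.map-cong f≡ ωs′) ⟨
  sumOver ωs′ f ∎
  where open ≡-Reasoning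

extend : (Fin k → Fin k) → Fin (k ℕ.+ m) → Fin (k ℕ.+ m)
extend {k} {m} f i = join k m (Sum.map₁ f (splitAt k i))

extend-inverse : ∀ {f g : Fin k → Fin k} → (∀ x → f (g x) ≡ x) →
  ∀ (i : Fin (k ℕ.+ m)) → extend f (extend g i) ≡ i
extend-inverse {k} {m} {f} {g} fg i = begin
  join k m (Sum.map₁ f (splitAt k (join k m (Sum.map₁ g (splitAt k i)))))
    ≡⟨ cong (join k m ∘ Sum.map₁ f) (FinP.splitAt-join k m (Sum.map₁ g (splitAt k i))) ⟩
  join k m (Sum.map₁ f (Sum.map₁ g (splitAt k i)))
    ≡⟨ cong (join k m) (map₁-inverse (splitAt k i)) ⟩
  join k m (splitAt k i)
    ≡⟨ FinP.join-splitAt k m i ⟩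
  i ∎
  where
  open ≡-Reasoning
  map₁-inverse : ∀ (s : Fin k ⊎ Fin m) → Sum.map₁ f (Sum.map₁ g s) ≡ s
  map₁-inverse (inj₁ x) = cong inj₁ (fg x)
  map₁-inverse (inj₂ _) = refl

extendPerm : Permutation′ k → Permutation′ (k ℕ.+ m)
extendPerm σ = permutation (extend (σ ⟨$⟩ʳ_)) (extend (σ ⟨$⟩ˡ_))
                           (extend-inverse (λ _ → inverseʳ σ)) (extend-inverse (λ _ → inverseˡ σ))

extend-≥ : ∀ (f : Fin k → Fin k) {i : Fin (k ℕ.+ m)} → k ≤ toℕ i → extend f i ≡ i
extend-≥ {k} {m} f {i} k≤i = begin
  join k m (Sum.map₁ f (splitAt k i)) ≡⟨ cong (join k m ∘ Sum.map₁ f) (FinP.splitAt-≥ k i k≤i) ⟩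
  join k m (inj₂ _)                   ≡⟨ cong (join k m) (FinP.splitAt-≥ k i k≤i) ⟨
  join k m (splitAt k i)              ≡⟨ FinP.join-splitAt k m i ⟩
  i                                   ∎
  where open ≡-Reasoning

toℕ-extend-< : ∀ (f : Fin k → Fin k) {i : Fin (k ℕ.+ m)} → toℕ i < k → toℕ (extend f i) < k
toℕ-extend-< {k} {m} f {i} i<k rewrite FinP.splitAt-< k i i<k =
  subst (_< k) (sym (FinP.toℕ-↑ˡ (f (fromℕ< i<k)) m)) (FinP.toℕ<n (f (fromℕ< i<k)))

extend-mono : ∀ (f : Fin k → Fin k) {i j : Fin (k ℕ.+ m)} → i Fin.< j → k ≤ toℕ j →
  extend f i Fin.< extend f j
extend-mono {k} f {i} {j} i<j k≤j rewrite extend-≥ f k≤j with toℕ i ℕ.<? k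
... | yes i<k = ℕP.<-≤-trans (toℕ-extend-< f i<k) k≤j
... | no i≮k  = subst (Fin._< j) (sym (extend-≥ f (ℕP.≮⇒≥ i≮k))) i<j

module ThreeBlock (m : ℕ) where

  N : ℕ
  N = 3 ℕ.+ m

  test : Permutation′ 3 → SignedPerm N
  test σ = mkSP (extendPerm σ) (λ _ → false)

  evens odds : List (Permutation′ 3)
  evens = id ∷ transpose 0F 1F ∘ₚ transpose 1F 2F ∷ transpose 1F 2F ∘ₚ transpose 0F 1F ∷ []
  odds  = transpose 0F 1F ∷ transpose 0F 2F ∷ transpose 1F 2F ∷ []

  -- A cell (i , +a) with i, a < 3 is hit by exactly one even and one odd
  -- test permutation; every other cell is hit by all six or by none.
  cell-balanced : ∀ i c →
    sumOver (map test evens) (indicator ⟨ i ↦ c ⟩) ≡ sumOver (map test odds) (indicator ⟨ i ↦ c ⟩)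
  cell-balanced i                   (true  , a)                 = refl
  cell-balanced (suc (suc (suc _))) (false , a)                 = refl
  cell-balanced 0F                  (false , 0F)                = refl
  cell-balanced 0F                  (false , 1F)                = refl
  cell-balanced 0F                  (false , 2F)                = refl
  cell-balanced 0F                  (false , suc (suc (suc _))) = refl
  cell-balanced 1F                  (false , 0F)                = refl
  cell-balanced 1F                  (false , 1F)                = refl
  cell-balanced 1F                  (false , 2F)                = refl
  cell-balanced 1F                  (false , suc (suc (suc _))) = refl
  cell-balanced 2F                  (false , 0F)                = refl
  cell-balanced 2F                  (false , 1F)                = refl
  cell-balanced 2F                  (false , 2F)                = refl
  cell-balanced 2F                  (false , suc (suc (suc _))) = refl

  indicator-balanced : ∀ P → size P ≤ 1 →
    sumOver (map test evens) (indicator P) ≡ sumOver (map test odds) (indicator P)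
  indicator-balanced (mkPCP []            _ _) _          = refl
  indicator-balanced (mkPCP ((i , c) ∷ []) _ _) _         = cell-balanced i c
  indicator-balanced (mkPCP (_ ∷ _ ∷ _)    _ _) (s≤s ())

  unbalanced⇒¬InSpan₁ : ∀ {f : SignedPerm N → ℚ} {h : Permutation′ 3 → ℚ} →
    (∀ σ → f (test σ) ≡ h σ) → sumℚ (map h evens) ≢ sumℚ (map h odds) → ¬ InSpan N 1 f
  unbalanced⇒¬InSpan₁ {f} {h} f∘test≡h unbalanced f∈span = unbalanced (begin
    sumℚ (map h evens)          ≡⟨ on evens ⟨
    sumOver (map test evens) f  ≡⟨ span-balanced (map test evens) (map test odds) indicator-balanced f∈span ⟩
    sumOver (map test odds) f   ≡⟨ on odds ⟩
    sumℚ (map h odds)           ∎)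
    where
    open ≡-Reasoning
    on : ∀ σs → sumOver (map test σs) f ≡ sumℚ (map h σs)
    on σs = cong sumℚ (trans (sym (ListP.map-∘ σs)) (ListP.map-cong f∘test≡h σs))

  test-increasing : ∀ σ {i j : Fin N} → i Fin.< j → 3 ≤ toℕ j → val (test σ) i ℤ.< val (test σ) j
  test-increasing σ i<j 3≤j = +<+ (s<s (extend-mono (σ ⟨$⟩ʳ_) i<j 3≤j))

  no-inversion-outside-block : ∀ σ {i j : Fin N} → 3 ≤ toℕ i ⊎ 3 ≤ toℕ j →
    inverted (test σ) i j ≡ false
  no-inversion-outside-block σ {i} {j} outside =
    Dec.dec-false ((i Fin.<? j) ×-dec (val (test σ) j ℤ.<? val (test σ) i)) λ (i<j , vⱼ<vᵢ) →
    ℤP.<-asym (test-increasing σ i<j (3≤j i<j outside)) vⱼ<vᵢ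
    where
    3≤j : i Fin.< j → 3 ≤ toℕ i ⊎ 3 ≤ toℕ j → 3 ≤ toℕ j
    3≤j i<j (inj₁ 3≤i) = ℕP.≤-trans 3≤i (ℕP.<⇒≤ i<j)
    3≤j _   (inj₂ 3≤j) = 3≤j

  sum-allFin-block : ∀ (g : Fin N → ℚ) → (∀ l → g (3 ↑ʳ l) ≡ 0ℚ) →
    sumℚ (map g (allFin N)) ≡ sumℚ (map (λ i → g (i ↑ˡ m)) (allFin 3))
  sum-allFin-block g g-tail =
    cong (λ t → g 0F ℚ.+ (g 1F ℚ.+ (g 2F ℚ.+ t))) (sumℚ-zero (AllP.tabulate⁺ g-tail))

  inv-test : ∀ σ → ℕtoℚ (inv (test σ)) ≡
    sumℚ (map (λ i → sumℚ (map (λ j → 𝟙 (inverted (test σ) (i ↑ˡ m) (j ↑ˡ m))) (allFin 3))) (allFin 3))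
  inv-test σ = begin
    ℕtoℚ (inv ω)
      ≡⟨ inv-as-sum ω ⟩
    sumℚ (map (λ p → 𝟙 (inverted ω (proj₁ p) (proj₂ p))) (allPairs N))
      ≡⟨ sum-allPairs (λ p → 𝟙 (inverted ω (proj₁ p) (proj₂ p))) ⟩
    sumℚ (map (λ i → sumℚ (map (λ j → 𝟙 (inverted ω i j)) (allFin N))) (allFin N))
      ≡⟨ sum-allFin-block (λ i → sumℚ (map (λ j → 𝟙 (inverted ω i j)) (allFin N)))
           (λ l → sumℚ-zero (All.universal (λ j → cong 𝟙 (no-inversion-outside-block σ {3 ↑ʳ l} {j} (inj₁ 3≤3+l))) (allFin N))) ⟩
    sumℚ (map (λ i → sumℚ (map (λ j → 𝟙 (inverted ω (i ↑ˡ m) j)) (allFin N))) (allFin 3))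
      ≡⟨ cong sumℚ (ListP.map-cong (λ i → sum-allFin-block (λ j → 𝟙 (inverted ω (i ↑ˡ m) j))
           (λ l → cong 𝟙 (no-inversion-outside-block σ {i ↑ˡ m} {3 ↑ʳ l} (inj₂ 3≤3+l)))) (allFin 3)) ⟩
    sumℚ (map (λ i → sumℚ (map (λ j → 𝟙 (inverted ω (i ↑ˡ m) (j ↑ˡ m))) (allFin 3))) (allFin 3)) ∎
    where
    open ≡-Reasoning
    ω = test σ
    3≤3+l : ∀ {l : Fin m} → 3 ≤ toℕ (3 ↑ʳ l)
    3≤3+l = s≤s (s≤s (s≤s z≤n))

  invB-test : ∀ σ → ℤtoℚ (invB (test σ)) ≡ ℕtoℚ (inv (test σ))
  invB-test σ = cong ℤtoℚ (trans (cong (λ z → + inv (test σ) ℤ.- z) (no-negatives (allFin N)))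
                                 (ℤP.+-identityʳ (+ inv (test σ))))
    where
    no-negatives : ∀ (xs : List (Fin N)) → foldr (λ _ acc → + 0 ℤ.+ acc) (+ 0) xs ≡ + 0
    no-negatives []       = refl
    no-negatives (_ ∷ xs) = trans (ℤP.+-identityˡ _) (no-negatives xs)

  desB-test : ∀ σ →
    desB (test σ) ≡ length (filter (λ k → ext (test σ) (suc k) ℤ.<? ext (test σ) k) (0 ∷ 1 ∷ 2 ∷ []))
  desB-test σ = begin
    desB ω
      ≡⟨⟩
    length (filter P? ((0 ∷ 1 ∷ 2 ∷ []) ++ applyUpTo (3 ℕ.+_) m))
      ≡⟨ cong length (ListP.filter-++ P? (0 ∷ 1 ∷ 2 ∷ []) (applyUpTo (3 ℕ.+_) m)) ⟩
    length (filter P? (0 ∷ 1 ∷ 2 ∷ []) ++ filter P? (applyUpTo (3 ℕ.+_) m))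
      ≡⟨ cong (λ t → length (filter P? (0 ∷ 1 ∷ 2 ∷ []) ++ t))
              (ListP.filter-none P? (AllP.applyUpTo⁺₁ _ m no-descent)) ⟩
    length (filter P? (0 ∷ 1 ∷ 2 ∷ []) ++ [])
      ≡⟨ cong length (ListP.++-identityʳ (filter P? (0 ∷ 1 ∷ 2 ∷ []))) ⟩
    length (filter P? (0 ∷ 1 ∷ 2 ∷ [])) ∎
    where
    open ≡-Reasoning
    ω = test σ
    P? = λ k → ext ω (suc k) ℤ.<? ext ω k
    no-descent : ∀ {x} → x < m → ¬ ext ω (suc (3 ℕ.+ x)) ℤ.< ext ω (3 ℕ.+ x)
    no-descent {x} x<m = ℤP.<-asym (subst₂ ℤ._<_ (sym (ext-suc ω p)) (sym (ext-suc ω q))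
      (test-increasing σ (subst₂ ℕ._<_ (sym (FinP.toℕ-fromℕ< p)) (sym (FinP.toℕ-fromℕ< q)) ℕP.≤-refl)
                         (subst (3 ≤_) (sym (FinP.toℕ-fromℕ< q)) (ℕP.m≤m+n 3 x))))
      where
      p : 2 ℕ.+ x < N
      p = ℕP.+-monoʳ-≤ 3 (ℕP.<⇒≤ x<m)
      q : 3 ℕ.+ x < N
      q = ℕP.+-monoʳ-< 3 x<m

  -- Both totals in each of the following normalise to distinct closed rationals.
  ¬InSpan₁-inv : ¬ InSpan N 1 (λ ω → ℕtoℚ (inv ω))
  ¬InSpan₁-inv = unbalanced⇒¬InSpan₁ inv-test (λ ())

  ¬InSpan₁-invB : ¬ InSpan N 1 (λ ω → ℤtoℚ (invB ω))
  ¬InSpan₁-invB = unbalanced⇒¬InSpan₁ (λ σ → trans (invB-test σ) (inv-test σ)) (λ ())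

  ¬InSpan₁-desB : ¬ InSpan N 1 (λ ω → ℕtoℚ (desB ω))
  ¬InSpan₁-desB = unbalanced⇒¬InSpan₁ (λ σ → cong ℕtoℚ (desB-test σ)) (λ ())

theorem4p20 : (n : ℕ) → 3 ≤ n →
    HasDegree2 n (λ ω → ℕtoℚ (inv ω)) ×
    HasDegree2 n (λ ω → ℤtoℚ (invB ω)) ×
    HasDegree2 n (λ ω → ℕtoℚ (desB ω))
theorem4p20 (suc (suc (suc m))) (s≤s (s≤s (s≤s z≤n))) =
  (InSpan-inv , ¬InSpan₁-inv) , (InSpan-invB , ¬InSpan₁-invB) , (InSpan-desB , ¬InSpan₁-desB)
  where open ThreeBlock m
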